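{- Let $n\ge 2$. Then \[ \sum_{\sigma\in D_n}(-1)^{\ell_D (\sigma)}x^{\mathrm{oinv} (\sigma) }y^{\mathrm{onsp} (\sigma)}= \Bigl(\sum_{\sigma\in S_n }(-1)^{\ell (\sigma)}x^{\mathrm{oinv} (\sigma)} \Bigr)\Bigl(\sum_{\sigma\in S_n }(-1)^{\ell (\sigma)}y^{\mathrm{oinv} (\sigma)}\Bigr). \]
   Context: $S_n$ is the symmetric group, with $\ell(\sigma)=\mathrm{inv}(\sigma)=|\{(i,j):1\le i<j\le n,\ \sigma(i)>\sigma(j)\}|$. $D_n$ is the group of signed permutations $\sigma$ of $[n]$ (bijections of $\{\pm1,\dots,\pm n\}$ with $\sigma(-i)=-\sigma(i)$) with an even number of negative entries in the window $[\sigma(1),\dots,\sigma(n)]$, with Coxeter length $\ell_D(\sigma)=\mathrm{inv}(\sigma)+\mathrm{nsp}(\sigma)$, $\mathrm{nsp}(\sigma)=|\{(i,j):i<j,\ \sigma(i)+\sigma(j)<0\}|$. $\mathrm{oinv}(\sigma)$ counts pairs $i<j$ with $\sigma(i)>\sigma(j)$ and $j-i$ odd; $\mathrm{onsp}(\sigma)$ counts pairs $i<j$ with $\sigma(i)+\sigma(j)<0$ and $j-i$ odd. -}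

module Defs where

open import Level using (Level)
open import Data.Bool using (Bool; true; false; if_then_else_)
open import Data.Nat as ℕ using (ℕ; zero; suc; _%_; _≡ᵇ_; _<ᵇ_)
open import Data.Integer as ℤ using (ℤ; +_; -_; 0ℤ)
open import Data.List using (List; []; _∷_; map; concatMap; filterᵇ; foldr)
open import Relation.Nullary using (does)
open import Algebra.Bundles using (CommutativeRing)

-- Enumerations. A permutation of [n] is represented by its window
-- [σ(1),…,σ(n)] as a list; a signed permutation by its window in ℤ.

insertAll : {A : Set} → A → List A → List (List A)
insertAll k [] = (k ∷ []) ∷ []
insertAll k (a ∷ as) = (k ∷ a ∷ as) ∷ map (a ∷_) (insertAll k as)

S : ℕ → List (List ℕ)
S zero = [] ∷ []
S (suc n) = concatMap (insertAll (suc n)) (S n)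

signings : List ℕ → List (List ℤ)
signings [] = [] ∷ []
signings (a ∷ as) =
  concatMap (λ w → ((+ a) ∷ w) ∷ ((- (+ a)) ∷ w) ∷ []) (signings as)

neg : List ℤ → ℕ
neg [] = 0
neg (a ∷ as) = (if does (a ℤ.<? 0ℤ) then 1 else 0) ℕ.+ neg as

B : ℕ → List (List ℤ)
B n = concatMap signings (S n)

D : ℕ → List (List ℤ)
D n = filterᵇ (λ w → (neg w % 2) ≡ᵇ 0) (B n)

-- Pair statistics. countPairs P w counts pairs of positions i < j in w
-- with P (j - i) (w i) (w j).

pairsFrom : {A : Set} → (ℕ → A → A → Bool) → ℕ → A → List A → ℕ
pairsFrom P d a [] = 0
pairsFrom P d a (b ∷ bs) = (if P d a b then 1 else 0) ℕ.+ pairsFrom P (suc d) a bs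

countPairs : {A : Set} → (ℕ → A → A → Bool) → List A → ℕ
countPairs P [] = 0
countPairs P (a ∷ as) = pairsFrom P 1 a as ℕ.+ countPairs P as

odd : ℕ → Bool
odd d = (d % 2) ≡ᵇ 1

invS : List ℕ → ℕ
invS = countPairs (λ _ a b → b <ᵇ a)

oinvS : List ℕ → ℕ
oinvS = countPairs (λ d a b → if odd d then b <ᵇ a else false)

invD : List ℤ → ℕ
invD = countPairs (λ _ a b → does (b ℤ.<? a))

nspD : List ℤ → ℕ
nspD = countPairs (λ _ a b → does ((a ℤ.+ b) ℤ.<? 0ℤ))

ℓD : List ℤ → ℕ
ℓD w = invD w ℕ.+ nspD w

oinvD : List ℤ → ℕ
oinvD = countPairs (λ d a b → if odd d then does (b ℤ.<? a) else false)

onspD : List ℤ → ℕ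
onspD = countPairs (λ d a b → if odd d then does ((a ℤ.+ b) ℤ.<? 0ℤ) else false)

module _ {c ℓ : Level} (R : CommutativeRing c ℓ) where
  open CommutativeRing R

  pow : Carrier → ℕ → Carrier
  pow x zero = 1#
  pow x (suc k) = x * pow x k

  sumR : List Carrier → Carrier
  sumR = foldr _+_ 0#

module Submission where

open import Defs
open import Level using (Level)
open import Data.Nat using (ℕ; _≤_)
open import Data.List using (map)
open import Algebra.Bundles using (CommutativeRing)

open import Data.Bool using (Bool; true; false; not; _∧_; _xor_; if_then_else_)
open import Data.Bool.Properties using (not-distribˡ-xor; not-distribʳ-xor)
open import Data.Nat using (zero; suc; _+_; _<_; s≤s; z≤n; _%_; _≡ᵇ_)
import Data.Nat.Properties as ℕP
open import Data.Nat.DivMod using ([m+n]%n≡m%n)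
open import Data.Nat.Solver using (module +-*-Solver)
open import Data.Integer as ℤ using (ℤ; +_; -[1+_]; 0ℤ)
import Data.Integer.Properties as ℤP
open import Data.List using (List; []; _∷_; _++_; length; concatMap; filterᵇ)
open import Data.List.Properties using (map-++; length-map)
open import Data.List.Relation.Unary.All as All using (All; []; _∷_)
open import Data.List.Relation.Unary.All.Properties using (map⁺; concat⁺; ++⁻ʳ)
open import Data.List.Relation.Unary.AllPairs using (AllPairs; []; _∷_)
open import Data.Maybe using (nothing)
open import Data.Product using (Σ-syntax; _×_; _,_; proj₁; proj₂)
open import Data.Empty using (⊥-elim)
open import Relation.Nullary using (does; ¬_)
open import Relation.Nullary.Decidable using (dec-true; dec-false)
open import Relation.Binary using (tri<; tri≈; tri>)
open import Relation.Binary.PropositionalEquality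
  using (_≡_; _≢_; refl; sym; trans; cong; cong₂; subst; subst₂)
import Relation.Binary.Reasoning.Setoid
open import Tactic.RingSolver.Core.AlmostCommutativeRing using (fromCommutativeRing)

open +-*-Solver using (solve; _:+_; _:=_; con)

-- Exchanging the two neighbours of ±n, signs included, changes ℓ_D by one and keeps oinv,
-- onsp and the number of negative entries: the exchanged entries are at the even distance
-- 2 and ±n compares with both in the same way.  A weight that changes sign under
-- exchanging two adjacent entries sums to zero over S_n, so only the permutations with
-- the maximum in front or at the end contribute (∑-boundary).  There ±n contributes an
-- explicit factor, (-1)^{n-1} x^k or (-1)^{n-1} y^k in front and 1 or x^k y^k at the end
-- (k = ⌈(n-1)/2⌉), a negative sign switching the parity of the number of negatives.  This
-- gives recursions for the even and the odd part E_n^0, E_n^1 of the signed D-type sum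
-- and for f_n, and induction with s² = 1 for s = (-1)^{n-1} shows E_n^0 = E_n^1 = f_n(x) f_n(y).

χ : Bool → ℕ
χ b = if b then 1 else 0

-- insertAt p k w inserts k in front of the p-th entry of w (at the end if p ≥ length w).
-- insertAll k w (from Defs) lists exactly the words insertAt p k w, p = 0,…,length w.
insertAt : {A : Set} → ℕ → A → List A → List A
insertAt zero k w = k ∷ w
insertAt (suc p) k [] = k ∷ []
insertAt (suc p) k (a ∷ w) = a ∷ insertAt p k w

length-insertAt : {A : Set} (p : ℕ) (k : A) (w : List A) → length (insertAt p k w) ≡ suc (length w)
length-insertAt zero k w = refl
length-insertAt (suc p) k [] = refl
length-insertAt (suc p) k (a ∷ w) = cong suc (length-insertAt p k w)

All-insertAt : {A : Set} {P : A → Set} (p : ℕ) {k : A} {w : List A} → P k → All P w → All P (insertAt p k w)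
All-insertAt zero pk pw = pk ∷ pw
All-insertAt (suc p) pk [] = pk ∷ []
All-insertAt (suc p) pk (pa ∷ pw) = pa ∷ All-insertAt p pk pw

insertAt-++ˡ : {A : Set} (p : ℕ) (k : A) (pre rest : List A) → p ≤ length pre →
  insertAt p k (pre ++ rest) ≡ insertAt p k pre ++ rest
insertAt-++ˡ zero k pre rest _ = refl
insertAt-++ˡ (suc p) k (c ∷ pre) rest (s≤s p≤) = cong (c ∷_) (insertAt-++ˡ p k pre rest p≤)

insertAt-++ʳ : {A : Set} {j : ℕ} (pre : List A) → length pre ≡ j → (p : ℕ) (k : A) (rest : List A) →
  insertAt (j + p) k (pre ++ rest) ≡ pre ++ insertAt p k rest
insertAt-++ʳ [] refl p k rest = refl
insertAt-++ʳ (c ∷ pre) refl p k rest = cong (c ∷_) (insertAt-++ʳ pre refl p k rest)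

insertAt-end : {A : Set} (k : A) (w : List A) → insertAt (length w) k w ≡ w ++ k ∷ []
insertAt-end k [] = refl
insertAt-end k (a ∷ w) = cong (a ∷_) (insertAt-end k w)

All-insertAll : {A : Set} {P : List A → Set} (k : A) (w : List A) →
  (∀ p → P (insertAt p k w)) → All P (insertAll k w)
All-insertAll k [] h = h zero ∷ []
All-insertAll {P = P} k (a ∷ w) h =
  h zero ∷ map⁺ (All-insertAll {P = λ u → P (a ∷ u)} k w (λ p → h (suc p)))

splitAt : {A : Set} (j : ℕ) (w : List A) → j < length w →
  Σ[ pre ∈ List A ] Σ[ a ∈ A ] Σ[ v ∈ List A ] (w ≡ pre ++ a ∷ v) × (length pre ≡ j)
splitAt zero (a ∷ w) _ = [] , a , w , refl , refl
splitAt (suc j) (c ∷ w) (s≤s j<) with splitAt j w j<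
... | pre , a , v , w≡ , len = c ∷ pre , a , v , cong (c ∷_) w≡ , cong suc len

-- The properties of a window of a permutation of [n] that the argument uses:
-- n entries, all at most n, pairwise distinct.
IsWindow : ℕ → List ℕ → Set
IsWindow n w = (length w ≡ n) × All (_≤ n) w × AllPairs _≢_ w

AllPairs-insertAt : (p : ℕ) {k : ℕ} {w : List ℕ} → All (k ≢_) w → AllPairs _≢_ w → AllPairs _≢_ (insertAt p k w)
AllPairs-insertAt zero k∉ ap = k∉ ∷ ap
AllPairs-insertAt (suc p) k∉ [] = [] ∷ []
AllPairs-insertAt (suc p) (k≢a ∷ k∉) (a∉ ∷ ap) =
  All-insertAt p (λ a≡k → k≢a (sym a≡k)) a∉ ∷ AllPairs-insertAt p k∉ ap

IsWindow-insertAt : {n : ℕ} (p : ℕ) {w : List ℕ} → IsWindow n w → IsWindow (suc n) (insertAt p (suc n) w)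
IsWindow-insertAt {n} p {w} (len , bounded , distinct) =
  trans (length-insertAt p (suc n) w) (cong suc len) ,
  All-insertAt p ℕP.≤-refl (All.map ℕP.m≤n⇒m≤1+n bounded) ,
  AllPairs-insertAt p (All.map (λ a≤n n+1≡a → ℕP.<⇒≢ (s≤s a≤n) (sym n+1≡a)) bounded) distinct

S-windows : (n : ℕ) → All (IsWindow n) (S n)
S-windows zero = (refl , [] , []) ∷ []
S-windows (suc n) =
  concat⁺ (map⁺ (All.map (λ wσ → All-insertAll (suc n) _ (λ p → IsWindow-insertAt p wσ)) (S-windows n)))

neighbours-distinct : (pre : List ℕ) {a b : ℕ} {v : List ℕ} → AllPairs _≢_ (pre ++ a ∷ b ∷ v) → a ≢ b
neighbours-distinct [] ((a≢b ∷ _) ∷ _) = a≢b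
neighbours-distinct (c ∷ pre) (_ ∷ ap) = neighbours-distinct pre ap

neighbours-bounded : {n : ℕ} (pre : List ℕ) {a b : ℕ} {v : List ℕ} →
  All (_≤ n) (pre ++ a ∷ b ∷ v) → (a ≤ n) × (b ≤ n)
neighbours-bounded pre bounded with ++⁻ʳ pre bounded
... | a≤n ∷ b≤n ∷ _ = a≤n , b≤n

module PairCounting {A : Set} (P : ℕ → A → A → Bool) where

  Periodic : Set
  Periodic = ∀ d a b → P (suc (suc d)) a b ≡ P d a b

  pairsFrom-periodic : Periodic → ∀ d a bs → pairsFrom P (suc (suc d)) a bs ≡ pairsFrom P d a bs
  pairsFrom-periodic per d a [] = refl
  pairsFrom-periodic per d a (b ∷ bs) = cong₂ _+_ (cong χ (per d a b)) (pairsFrom-periodic per (suc d) a bs)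

  -- Exchanging b and a across one middle entry keeps their distances to an earlier entry c
  -- up to 2, so a periodic test counts the same pairs with c.
  pairsFrom-swap : Periodic → ∀ d c pre a m b v →
    pairsFrom P d c (pre ++ b ∷ m ∷ a ∷ v) ≡ pairsFrom P d c (pre ++ a ∷ m ∷ b ∷ v)
  pairsFrom-swap per d c [] a m b v rewrite per d c a | per d c b =
    solve 4 (λ cb cm ca rest → cb :+ (cm :+ (ca :+ rest)) := ca :+ (cm :+ (cb :+ rest))) refl
      (χ (P d c b)) (χ (P (suc d) c m)) (χ (P d c a)) (pairsFrom P (suc (suc (suc d))) c v)
  pairsFrom-swap per d c (e ∷ pre) a m b v = cong (λ n → χ (P d c e) + n) (pairsFrom-swap per (suc d) c pre a m b v)

  countPairs-swap : Periodic → ∀ a m b → χ (P 1 a m) + χ (P 1 m b) ≡ χ (P 1 b m) + χ (P 1 m a) → ∀ pre v →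
    countPairs P (pre ++ b ∷ m ∷ a ∷ v) + χ (P 2 a b) ≡ countPairs P (pre ++ a ∷ m ∷ b ∷ v) + χ (P 2 b a)
  countPairs-swap per a m b middle [] v
    rewrite pairsFrom-periodic per 1 b v | pairsFrom-periodic per 1 a v =
      trans (solve 8 (λ bm ba bv ma mv av rest ab →
                ((bm :+ (ba :+ bv)) :+ ((ma :+ mv) :+ (av :+ rest))) :+ ab
                  := (bm :+ ma) :+ (ab :+ ba :+ av :+ bv :+ mv :+ rest)) refl
               bm ba bv ma mv av rest ab)
      (trans (cong (_+ (ab + ba + av + bv + mv + rest)) (sym middle))
        (solve 8 (λ ba bv mv av rest ab am mb →
                (am :+ mb) :+ (ab :+ ba :+ av :+ bv :+ mv :+ rest)
                  := ((am :+ (ab :+ av)) :+ ((mb :+ mv) :+ (bv :+ rest))) :+ ba) refl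
               ba bv mv av rest ab am mb))
    where
    bm ba bv ma mv av rest ab am mb : ℕ
    bm = χ (P 1 b m); ba = χ (P 2 b a); bv = pairsFrom P 1 b v
    ma = χ (P 1 m a); mv = pairsFrom P 2 m v; av = pairsFrom P 1 a v
    rest = countPairs P v; ab = χ (P 2 a b); am = χ (P 1 a m); mb = χ (P 1 m b)
  countPairs-swap per a m b middle (e ∷ pre) v =
    trans (ℕP.+-assoc (pairsFrom P 1 e (pre ++ b ∷ m ∷ a ∷ v)) _ _)
      (trans (cong₂ _+_ (pairsFrom-swap per 1 e pre a m b v) (countPairs-swap per a m b middle pre v))
        (sym (ℕP.+-assoc (pairsFrom P 1 e (pre ++ a ∷ m ∷ b ∷ v)) _ _)))

  pairsTo : List A → A → ℕ
  pairsTo [] z = 0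
  pairsTo (a ∷ as) z = χ (P (suc (length as)) a z) + pairsTo as z

  pairsFrom-snoc : ∀ d a as z → pairsFrom P d a (as ++ z ∷ []) ≡ pairsFrom P d a as + χ (P (d + length as) a z)
  pairsFrom-snoc d a [] z rewrite ℕP.+-identityʳ d = ℕP.+-comm (χ (P d a z)) 0
  pairsFrom-snoc d a (b ∷ as) z rewrite pairsFrom-snoc (suc d) a as z | ℕP.+-suc d (length as) =
    sym (ℕP.+-assoc (χ (P d a b)) _ _)

  countPairs-snoc : ∀ t z → countPairs P (t ++ z ∷ []) ≡ countPairs P t + pairsTo t z
  countPairs-snoc [] z = refl
  countPairs-snoc (a ∷ t) z rewrite pairsFrom-snoc 1 a t z | countPairs-snoc t z =
    solve 4 (λ p q c l → (p :+ q) :+ (c :+ l) := (p :+ c) :+ (q :+ l)) refl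
      (pairsFrom P 1 a t) (χ (P (suc (length t)) a z)) (countPairs P t) (pairsTo t z)

countUpTo : (ℕ → Bool) → ℕ → ℕ
countUpTo Q zero = 0
countUpTo Q (suc l) = χ (Q (suc l)) + countUpTo Q l

countFrom : (ℕ → Bool) → ℕ → ℕ → ℕ
countFrom Q d zero = 0
countFrom Q d (suc l) = χ (Q d) + countFrom Q (suc d) l

countFrom-snoc : ∀ Q d l → countFrom Q d (suc l) ≡ countFrom Q d l + χ (Q (d + l))
countFrom-snoc Q d zero rewrite ℕP.+-identityʳ d = ℕP.+-comm (χ (Q d)) 0
countFrom-snoc Q d (suc l) rewrite countFrom-snoc Q (suc d) l | ℕP.+-suc d l =
  sym (ℕP.+-assoc (χ (Q d)) _ _)

countFrom-one : ∀ Q l → countFrom Q 1 l ≡ countUpTo Q l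
countFrom-one Q zero = refl
countFrom-one Q (suc l) rewrite countFrom-snoc Q 1 l | countFrom-one Q l = ℕP.+-comm (countUpTo Q l) _

countUpTo-true : ∀ l → countUpTo (λ _ → true) l ≡ l
countUpTo-true zero = refl
countUpTo-true (suc l) = cong suc (countUpTo-true l)

countUpTo-false : ∀ l → countUpTo (λ _ → false) l ≡ 0
countUpTo-false zero = refl
countUpTo-false (suc l) = countUpTo-false l

module ConstantTest {A : Set} (P : ℕ → A → A → Bool) (Q : ℕ → Bool) where
  open PairCounting P

  pairsFrom-const : ∀ d m bs → All (λ b → ∀ d → P d m b ≡ Q d) bs → pairsFrom P d m bs ≡ countFrom Q d (length bs)
  pairsFrom-const d m [] [] = refl
  pairsFrom-const d m (b ∷ bs) (h ∷ hs) = cong₂ _+_ (cong χ (h d)) (pairsFrom-const (suc d) m bs hs)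

  pairsTo-const : ∀ t z → All (λ a → ∀ d → P d a z ≡ Q d) t → pairsTo t z ≡ countUpTo Q (length t)
  pairsTo-const [] z [] = refl
  pairsTo-const (a ∷ t) z (h ∷ hs) = cong₂ _+_ (cong χ (h _)) (pairsTo-const t z hs)

  countPairs-const-front : ∀ m t → All (λ b → ∀ d → P d m b ≡ Q d) t →
    countPairs P (m ∷ t) ≡ countUpTo Q (length t) + countPairs P t
  countPairs-const-front m t h =
    cong (_+ countPairs P t) (trans (pairsFrom-const 1 m t h) (countFrom-one Q (length t)))

  countPairs-const-back : ∀ t z → All (λ a → ∀ d → P d a z ≡ Q d) t →
    countPairs P (t ++ z ∷ []) ≡ countPairs P t + countUpTo Q (length t)
  countPairs-const-back t z h = trans (countPairs-snoc t z) (cong (λ n → countPairs P t + n) (pairsTo-const t z h))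

countPairs-map : {A B : Set} (P : ℕ → B → B → Bool) (f : A → B) (w : List A) →
  countPairs P (map f w) ≡ countPairs (λ d a b → P d (f a) (f b)) w
countPairs-map P f [] = refl
countPairs-map P f (a ∷ w) = cong₂ _+_ (pairsFrom-map 1 w) (countPairs-map P f w)
  where
  pairsFrom-map : ∀ d bs → pairsFrom P d (f a) (map f bs) ≡ pairsFrom (λ d a b → P d (f a) (f b)) d a bs
  pairsFrom-map d [] = refl
  pairsFrom-map d (b ∷ bs) = cong (λ n → χ (P d (f a) (f b)) + n) (pairsFrom-map (suc d) bs)

countPairs-never : {A : Set} (P : ℕ → A → A → Bool) → (∀ d a b → P d a b ≡ false) → ∀ w → countPairs P w ≡ 0
countPairs-never P never [] = refl
countPairs-never P never (a ∷ w) = cong₂ _+_ (pairsFrom-never 1 w) (countPairs-never P never w)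
  where
  pairsFrom-never : ∀ d bs → pairsFrom P d a bs ≡ 0
  pairsFrom-never d [] = refl
  pairsFrom-never d (b ∷ bs) rewrite never d a b = pairsFrom-never (suc d) bs

-- A test on values, only applied at the distances d with g d.  All four statistics of
-- Defs are of this form: inv, nsp with g = always and oinv, onsp with g = odd.
gated : {A : Set} → (ℕ → Bool) → (A → A → Bool) → ℕ → A → A → Bool
gated g R d a b = if g d then R a b else false

always : ℕ → Bool
always _ = true

when : Bool → ℕ → ℕ
when r k = if r then k else 0

module GatedCounting {A : Set} (g : ℕ → Bool) (R : A → A → Bool) where
  open PairCounting (gated g R)

  count : List A → ℕ
  count = countPairs (gated g R)

  private
    if-as-∧ : ∀ x r → (if x then r else false) ≡ r ∧ x
    if-as-∧ true true = refl
    if-as-∧ true false = refl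
    if-as-∧ false true = refl
    if-as-∧ false false = refl

    gated-const : ∀ {a b r} → R a b ≡ r → ∀ d → gated g R d a b ≡ r ∧ g d
    gated-const {r = r} Rab≡r d = trans (cong (λ s → if g d then s else false) Rab≡r) (if-as-∧ (g d) r)

    countUpTo-when : ∀ r l → countUpTo (λ d → r ∧ g d) l ≡ when r (countUpTo g l)
    countUpTo-when true l = refl
    countUpTo-when false l = countUpTo-false l

  count-front : ∀ r m t → All (λ b → R m b ≡ r) t → count (m ∷ t) ≡ when r (countUpTo g (length t)) + count t
  count-front r m t same =
    trans (ConstantTest.countPairs-const-front (gated g R) (λ d → r ∧ g d) m t (All.map gated-const same))
      (cong (_+ count t) (countUpTo-when r (length t)))

  count-back : ∀ r t z → All (λ a → R a z ≡ r) t → count (t ++ z ∷ []) ≡ count t + when r (countUpTo g (length t))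
  count-back r t z same =
    trans (ConstantTest.countPairs-const-back (gated g R) (λ d → r ∧ g d) t z (All.map gated-const same))
      (cong (λ n → count t + n) (countUpTo-when r (length t)))

  count-swap : (∀ d → g (suc (suc d)) ≡ g d) → g 1 ≡ true → ∀ a m b → R a m ≡ R b m → R m b ≡ R m a → ∀ pre v →
    count (pre ++ b ∷ m ∷ a ∷ v) + χ (gated g R 2 a b) ≡ count (pre ++ a ∷ m ∷ b ∷ v) + χ (gated g R 2 b a)
  count-swap g-periodic g1 a m b am≡bm mb≡ma = countPairs-swap periodic a m b middle
    where
    periodic : Periodic
    periodic d a b = cong (λ s → if s then R a b else false) (g-periodic d)
    at-1 : ∀ a b → gated g R 1 a b ≡ R a b
    at-1 a b = cong (λ s → if s then R a b else false) g1
    middle : χ (gated g R 1 a m) + χ (gated g R 1 m b) ≡ χ (gated g R 1 b m) + χ (gated g R 1 m a)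
    middle = cong₂ _+_ (cong χ (trans (at-1 a m) (trans am≡bm (sym (at-1 b m)))))
                       (cong χ (trans (at-1 m b) (trans mb≡ma (sym (at-1 m a)))))

%2-periodic : ∀ d → suc (suc d) % 2 ≡ d % 2
%2-periodic d = trans (cong (_% 2) (ℕP.+-comm 2 d)) ([m+n]%n≡m%n d 2)

odd-periodic : ∀ d → odd (suc (suc d)) ≡ odd d
odd-periodic d = cong (λ r → r ≡ᵇ 1) (%2-periodic d)

-- Thus invD = count always inversion, oinvD = count odd inversion,
-- nspD = count always negSum, onspD = count odd negSum, all definitionally.
inversion negSum : ℤ → ℤ → Bool
inversion a b = does (b ℤ.<? a)
negSum a b = does ((a ℤ.+ b) ℤ.<? 0ℤ)

module Inv = GatedCounting always inversion
module Nsp = GatedCounting always negSum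
module OInv = GatedCounting odd inversion
module ONsp = GatedCounting odd negSum

Bounded : ℕ → List ℤ → Set
Bounded n = All (λ a → ℤ.∣ a ∣ ≤ n)

sgn : Bool → ℕ → ℤ
sgn true a = + a
sgn false a = ℤ.- (+ a)

∣sgn∣ : ∀ e a → ℤ.∣ sgn e a ∣ ≡ a
∣sgn∣ true a = refl
∣sgn∣ false zero = refl
∣sgn∣ false (suc a) = refl

top : Bool → ℕ → ℤ
top e n = sgn e (suc n)

<-+top : ∀ {n} a → ℤ.∣ a ∣ ≤ n → a ℤ.< + suc n
<-+top (+ k) k≤n = ℤ.+<+ (s≤s k≤n)
<-+top -[1+ k ] _ = ℤ.-<+

>--top : ∀ {n} a → ℤ.∣ a ∣ ≤ n → -[1+ n ] ℤ.< a
>--top (+ k) _ = ℤ.-<+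
>--top -[1+ k ] k<n = ℤ.-<- k<n

+top-sum-≮0 : ∀ {n} a → ℤ.∣ a ∣ ≤ n → ¬ (+ suc n ℤ.+ a ℤ.< 0ℤ)
+top-sum-≮0 (+ k) _ (ℤ.+<+ ())
+top-sum-≮0 -[1+ k ] k<n sum<0 = ℤP.+≮0 (subst (ℤ._< 0ℤ) (ℤP.⊖-≥ (ℕP.m≤n⇒m≤1+n k<n)) sum<0)

-top-sum-<0 : ∀ {n} a → ℤ.∣ a ∣ ≤ n → -[1+ n ] ℤ.+ a ℤ.< 0ℤ
-top-sum-<0 {n} (+ k) k≤n =
  subst (ℤ._< 0ℤ) (sym (trans (ℤP.⊖-< (s≤s k≤n)) (cong (λ z → ℤ.- (+ z)) (ℕP.+-∸-assoc 1 k≤n)))) ℤ.-<+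
-top-sum-<0 -[1+ k ] _ = ℤ.-<+

inversion-from-top : ∀ {n} e a → ℤ.∣ a ∣ ≤ n → inversion (top e n) a ≡ e
inversion-from-top {n} true a a≤n = dec-true (a ℤ.<? + suc n) (<-+top a a≤n)
inversion-from-top {n} false a a≤n = dec-false (a ℤ.<? -[1+ n ]) (ℤP.<-asym (>--top a a≤n))

inversion-to-top : ∀ {n} e a → ℤ.∣ a ∣ ≤ n → inversion a (top e n) ≡ not e
inversion-to-top {n} true a a≤n = dec-false (+ suc n ℤ.<? a) (ℤP.<-asym (<-+top a a≤n))
inversion-to-top {n} false a a≤n = dec-true (-[1+ n ] ℤ.<? a) (>--top a a≤n)

negSum-from-top : ∀ {n} e a → ℤ.∣ a ∣ ≤ n → negSum (top e n) a ≡ not e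
negSum-from-top {n} true a a≤n = dec-false ((+ suc n ℤ.+ a) ℤ.<? 0ℤ) (+top-sum-≮0 a a≤n)
negSum-from-top {n} false a a≤n = dec-true ((-[1+ n ] ℤ.+ a) ℤ.<? 0ℤ) (-top-sum-<0 a a≤n)

negSum-to-top : ∀ {n} e a → ℤ.∣ a ∣ ≤ n → negSum a (top e n) ≡ not e
negSum-to-top {n} e a a≤n = trans (cong (λ s → does (s ℤ.<? 0ℤ)) (ℤP.+-comm a (top e n))) (negSum-from-top e a a≤n)

module Extreme {n : ℕ} (e : Bool) {t : List ℤ} (bounded : Bounded n t) where
  private
    l : ℕ
    l = length t
    m : ℤ
    m = top e n

  invD-front : invD (m ∷ t) ≡ when e l + invD t
  invD-front = trans (Inv.count-front e m t (All.map (λ {c} → inversion-from-top e c) bounded))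
                     (cong (λ k → when e k + invD t) (countUpTo-true l))

  nspD-front : nspD (m ∷ t) ≡ when (not e) l + nspD t
  nspD-front = trans (Nsp.count-front (not e) m t (All.map (λ {c} → negSum-from-top e c) bounded))
                     (cong (λ k → when (not e) k + nspD t) (countUpTo-true l))

  oinvD-front : oinvD (m ∷ t) ≡ when e (countUpTo odd l) + oinvD t
  oinvD-front = OInv.count-front e m t (All.map (λ {c} → inversion-from-top e c) bounded)

  onspD-front : onspD (m ∷ t) ≡ when (not e) (countUpTo odd l) + onspD t
  onspD-front = ONsp.count-front (not e) m t (All.map (λ {c} → negSum-from-top e c) bounded)

  invD-back : invD (t ++ m ∷ []) ≡ invD t + when (not e) l
  invD-back = trans (Inv.count-back (not e) t m (All.map (λ {c} → inversion-to-top e c) bounded))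
                    (cong (λ k → invD t + when (not e) k) (countUpTo-true l))

  nspD-back : nspD (t ++ m ∷ []) ≡ nspD t + when (not e) l
  nspD-back = trans (Nsp.count-back (not e) t m (All.map (λ {c} → negSum-to-top e c) bounded))
                    (cong (λ k → nspD t + when (not e) k) (countUpTo-true l))

  oinvD-back : oinvD (t ++ m ∷ []) ≡ oinvD t + when (not e) (countUpTo odd l)
  oinvD-back = OInv.count-back (not e) t m (All.map (λ {c} → inversion-to-top e c) bounded)

  onspD-back : onspD (t ++ m ∷ []) ≡ onspD t + when (not e) (countUpTo odd l)
  onspD-back = ONsp.count-back (not e) t m (All.map (λ {c} → negSum-to-top e c) bounded)

-- The statistics after exchanging the two neighbours a, b of an extreme value: only the
-- pair {a, b} changes its contribution, and it lies at the even distance 2, so oinv and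
-- onsp are unchanged, nsp is unchanged as a + b = b + a, and inv moves by one.
module ExtremeSwap {n : ℕ} (e : Bool) {a b : ℤ} (a≤n : ℤ.∣ a ∣ ≤ n) (b≤n : ℤ.∣ b ∣ ≤ n) (pre v : List ℤ) where
  private
    m : ℤ
    m = top e n
    τ τ' : List ℤ
    τ = pre ++ a ∷ m ∷ b ∷ v
    τ' = pre ++ b ∷ m ∷ a ∷ v
    same-to : (R : ℤ → ℤ → Bool) → (∀ c → ℤ.∣ c ∣ ≤ n → R c m ≡ not e) → R a m ≡ R b m
    same-to R to = trans (to a a≤n) (sym (to b b≤n))
    same-from : (R : ℤ → ℤ → Bool) (r : Bool) → (∀ c → ℤ.∣ c ∣ ≤ n → R m c ≡ r) → R m b ≡ R m a
    same-from R r from = trans (from b b≤n) (sym (from a a≤n))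

  invD-swap : invD τ' + χ (inversion a b) ≡ invD τ + χ (inversion b a)
  invD-swap = Inv.count-swap (λ _ → refl) refl a m b
    (same-to inversion (inversion-to-top e)) (same-from inversion e (inversion-from-top e)) pre v

  nspD-swap : nspD τ' ≡ nspD τ
  nspD-swap = ℕP.+-cancelʳ-≡ _ _ _
    (trans (Nsp.count-swap (λ _ → refl) refl a m b
              (same-to negSum (negSum-to-top e)) (same-from negSum (not e) (negSum-from-top e)) pre v)
           (cong (λ s → nspD τ + χ (does (s ℤ.<? 0ℤ))) (ℤP.+-comm b a)))

  oinvD-swap : oinvD τ' ≡ oinvD τ
  oinvD-swap = ℕP.+-cancelʳ-≡ 0 _ _ (OInv.count-swap odd-periodic refl a m b
    (same-to inversion (inversion-to-top e)) (same-from inversion e (inversion-from-top e)) pre v)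

  onspD-swap : onspD τ' ≡ onspD τ
  onspD-swap = ℕP.+-cancelʳ-≡ 0 _ _ (ONsp.count-swap odd-periodic refl a m b
    (same-to negSum (negSum-to-top e)) (same-from negSum (not e) (negSum-from-top e)) pre v)

  invD-swap-< : a ℤ.< b → invD τ' ≡ suc (invD τ)
  invD-swap-< a<b = trans (sym (ℕP.+-identityʳ _)) (trans counted (ℕP.+-comm (invD τ) 1))
    where
    counted : invD τ' + 0 ≡ invD τ + 1
    counted = subst₂ (λ r s → invD τ' + χ r ≡ invD τ + χ s)
      (dec-false (b ℤ.<? a) (ℤP.<-asym a<b)) (dec-true (a ℤ.<? b) a<b) invD-swap

  invD-swap-> : b ℤ.< a → invD τ ≡ suc (invD τ')
  invD-swap-> b<a = trans (sym (ℕP.+-identityʳ _)) (trans (sym counted) (ℕP.+-comm (invD τ') 1))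
    where
    counted : invD τ' + 1 ≡ invD τ + 0
    counted = subst₂ (λ r s → invD τ' + χ r ≡ invD τ + χ s)
      (dec-true (b ℤ.<? a) b<a) (dec-false (a ℤ.<? b) (ℤP.<-asym b<a)) invD-swap

-- Parity of a number of negative entries (true = even), as in the definition of D.
ev : ℕ → Bool
ev k = (k % 2) ≡ᵇ 0

ev-suc : ∀ k → ev (suc k) ≡ not (ev k)
ev-suc zero = refl
ev-suc (suc zero) = refl
ev-suc (suc (suc k)) rewrite %2-periodic (suc k) | %2-periodic k = ev-suc k

neg-++ : (pre rest : List ℤ) → neg (pre ++ rest) ≡ neg pre + neg rest
neg-++ [] rest = refl
neg-++ (c ∷ pre) rest = trans (cong (λ k → χ (does (c ℤ.<? 0ℤ)) + k) (neg-++ pre rest))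
                              (sym (ℕP.+-assoc (χ (does (c ℤ.<? 0ℤ))) _ _))

neg-swap : (pre : List ℤ) (a m b : ℤ) (v : List ℤ) → neg (pre ++ b ∷ m ∷ a ∷ v) ≡ neg (pre ++ a ∷ m ∷ b ∷ v)
neg-swap pre a m b v rewrite neg-++ pre (b ∷ m ∷ a ∷ v) | neg-++ pre (a ∷ m ∷ b ∷ v) =
  cong (λ k → neg pre + k)
    (solve 4 (λ nb nm na nv → nb :+ (nm :+ (na :+ nv)) := na :+ (nm :+ (nb :+ nv))) refl
      (χ (does (b ℤ.<? 0ℤ))) (χ (does (m ℤ.<? 0ℤ))) (χ (does (a ℤ.<? 0ℤ))) (neg v))

signings-shape : ∀ {n} (σ : List ℕ) → All (_≤ n) σ → All (λ t → (length t ≡ length σ) × Bounded n t) (signings σ)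
signings-shape [] [] = (refl , []) ∷ []
signings-shape {n} (a ∷ σ) (a≤n ∷ σ≤n) =
  concat⁺ (map⁺ (All.map (λ { (len , bounded) →
      (cong suc len , subst (_≤ n) (sym (∣sgn∣ true a)) a≤n ∷ bounded) ∷
      (cong suc len , subst (_≤ n) (sym (∣sgn∣ false a)) a≤n ∷ bounded) ∷ [] })
    (signings-shape σ σ≤n)))

positive-bounded : ∀ {n} (σ : List ℕ) → All (_≤ n) σ → Bounded n (map +_ σ)
positive-bounded [] [] = []
positive-bounded (a ∷ σ) (a≤n ∷ σ≤n) = a≤n ∷ positive-bounded σ σ≤n

module Sums {r ℓ : Level} (R : CommutativeRing r ℓ) where
  open CommutativeRing R renaming (_+_ to _+ᵣ_; refl to ≈-refl; sym to ≈-sym; trans to ≈-trans)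
  open import Algebra.Properties.Ring ring using (-‿involutive; -0#≈0#; -1*x≈-x; -‿distribˡ-*; -‿distribʳ-*)
  open import Algebra.Properties.CommutativeSemigroup +-commutativeSemigroup using (interchange)
  open import Algebra.Properties.CommutativeSemigroup *-commutativeSemigroup using () renaming (interchange to *-interchange)
  open import Relation.Binary.Reasoning.Setoid setoid
  import Tactic.RingSolver.NonReflective (fromCommutativeRing R (λ _ → nothing)) as RS
  open RS using (_⊕_; _⊜_; ⊝_)

  ∑ : {A : Set} → (A → Carrier) → List A → Carrier
  ∑ f L = sumR R (map f L)

  ∑-cong : {A : Set} {f g : A → Carrier} (L : List A) → (∀ a → f a ≈ g a) → ∑ f L ≈ ∑ g L
  ∑-cong [] f≈g = ≈-refl
  ∑-cong (a ∷ L) f≈g = +-cong (f≈g a) (∑-cong L f≈g)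

  ∑-congᴬ : {A : Set} {f g : A → Carrier} {L : List A} → All (λ a → f a ≈ g a) L → ∑ f L ≈ ∑ g L
  ∑-congᴬ [] = ≈-refl
  ∑-congᴬ (f≈g ∷ fs≈gs) = +-cong f≈g (∑-congᴬ fs≈gs)

  ∑-++ : {A : Set} (f : A → Carrier) (xs ys : List A) → ∑ f (xs ++ ys) ≈ ∑ f xs +ᵣ ∑ f ys
  ∑-++ f [] ys = ≈-sym (+-identityˡ _)
  ∑-++ f (x ∷ xs) ys = ≈-trans (+-cong ≈-refl (∑-++ f xs ys)) (≈-sym (+-assoc _ _ _))

  ∑-concatMap : {A B : Set} (f : B → Carrier) (h : A → List B) (L : List A) →
    ∑ f (concatMap h L) ≈ ∑ (λ a → ∑ f (h a)) L
  ∑-concatMap f h [] = ≈-refl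
  ∑-concatMap f h (a ∷ L) = ≈-trans (∑-++ f (h a) (concatMap h L)) (+-cong ≈-refl (∑-concatMap f h L))

  ∑-filter : {A : Set} (p : A → Bool) (f : A → Carrier) (L : List A) →
    ∑ f (filterᵇ p L) ≈ ∑ (λ a → if p a then f a else 0#) L
  ∑-filter p f [] = ≈-refl
  ∑-filter p f (a ∷ L) with p a
  ... | true = +-cong ≈-refl (∑-filter p f L)
  ... | false = ≈-trans (∑-filter p f L) (≈-sym (+-identityˡ _))

  ∑-+ : {A : Set} (f g : A → Carrier) (L : List A) → ∑ (λ a → f a +ᵣ g a) L ≈ ∑ f L +ᵣ ∑ g L
  ∑-+ f g [] = ≈-sym (+-identityʳ 0#)
  ∑-+ f g (a ∷ L) = ≈-trans (+-cong ≈-refl (∑-+ f g L)) (interchange _ _ _ _)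

  ∑-* : {A : Set} (k : Carrier) (f : A → Carrier) (L : List A) → ∑ (λ a → k * f a) L ≈ k * ∑ f L
  ∑-* k f [] = ≈-sym (zeroʳ k)
  ∑-* k f (a ∷ L) = ≈-trans (+-cong ≈-refl (∑-* k f L)) (≈-sym (distribˡ k _ _))

  ∑-neg : {A : Set} (f : A → Carrier) (L : List A) → ∑ (λ a → - f a) L ≈ - ∑ f L
  ∑-neg f [] = ≈-sym -0#≈0#
  ∑-neg f (a ∷ L) = ≈-trans (+-cong ≈-refl (∑-neg f L))
    (RS.solve 2 (λ p q → (⊝ p ⊕ ⊝ q) ⊜ ⊝ (p ⊕ q)) ≈-refl (f a) (∑ f L))

  ∑-zero : {A : Set} (L : List A) → ∑ (λ _ → 0#) L ≈ 0#
  ∑-zero [] = ≈-refl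
  ∑-zero (a ∷ L) = ≈-trans (+-identityˡ _) (∑-zero L)

  ∑-map : {A B : Set} (f : B → Carrier) (g : A → B) (L : List A) → ∑ f (map g L) ≈ ∑ (λ a → f (g a)) L
  ∑-map f g [] = ≈-refl
  ∑-map f g (a ∷ L) = +-cong ≈-refl (∑-map f g L)

  ∑-linear : {A : Set} (c d : Carrier) (f g : A → Carrier) (L : List A) →
    ∑ (λ a → c * f a +ᵣ d * g a) L ≈ c * ∑ f L +ᵣ d * ∑ g L
  ∑-linear c d f g L = ≈-trans (∑-+ _ _ L) (+-cong (∑-* c f L) (∑-* d g L))

  sumBelow : (ℕ → Carrier) → ℕ → Carrier
  sumBelow a zero = 0#
  sumBelow a (suc N) = a 0 +ᵣ sumBelow (λ p → a (suc p)) N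

  sumBelow-zero : ∀ N (a : ℕ → Carrier) → (∀ p → p < N → a p ≈ 0#) → sumBelow a N ≈ 0#
  sumBelow-zero zero a vanish = ≈-refl
  sumBelow-zero (suc N) a vanish =
    ≈-trans (+-cong (vanish 0 (s≤s z≤n)) (sumBelow-zero N _ (λ p p<N → vanish (suc p) (s≤s p<N)))) (+-identityˡ 0#)

  ∑-sumBelow : {A : Set} (L : List A) (f : A → ℕ → Carrier) (N : ℕ) →
    ∑ (λ σ → sumBelow (f σ) N) L ≈ sumBelow (λ p → ∑ (λ σ → f σ p) L) N
  ∑-sumBelow L f zero = ∑-zero L
  ∑-sumBelow L f (suc N) =
    ≈-trans (∑-+ (λ σ → f σ 0) (λ σ → sumBelow (λ p → f σ (suc p)) N) L)
            (+-cong ≈-refl (∑-sumBelow L (λ σ p → f σ (suc p)) N))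

  -- A sum over positions vanishes if its terms vanish except at j and j + 1, where
  -- they cancel.  Positions are written j + offset so that shifting j is definitional.
  sumBelow-cancel : ∀ j N (a : ℕ → Carrier) → suc j < N → (∀ p → p < j → a p ≈ 0#) →
    (∀ r → j + suc (suc r) < N → a (j + suc (suc r)) ≈ 0#) → a (j + 0) +ᵣ a (j + 1) ≈ 0# → sumBelow a N ≈ 0#
  sumBelow-cancel zero (suc zero) a (s≤s ()) before after pair
  sumBelow-cancel zero (suc (suc N)) a _ before after pair =
    ≈-trans (≈-sym (+-assoc _ _ _))
      (≈-trans (+-cong pair (sumBelow-zero N _ (λ p p<N → after p (s≤s (s≤s p<N))))) (+-identityˡ 0#))
  sumBelow-cancel (suc j) (suc N) a (s≤s j+1<N) before after pair =
    ≈-trans (+-cong (before 0 (s≤s z≤n))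
                    (sumBelow-cancel j N (λ p → a (suc p)) j+1<N (λ p p<j → before (suc p) (s≤s p<j))
                      (λ r lt → after r (s≤s lt)) pair))
            (+-identityˡ 0#)

  sumBelow-ends : ∀ m (a : ℕ → Carrier) → (∀ q → q < m → a (q + 1) ≈ 0#) → sumBelow a (suc (suc m)) ≈ a 0 +ᵣ a (suc m)
  sumBelow-ends zero a inner = +-cong ≈-refl (+-identityʳ _)
  sumBelow-ends (suc m) a inner =
    +-cong ≈-refl (≈-trans (sumBelow-ends m (λ p → a (suc p)) (λ q q<m → inner (suc q) (s≤s q<m)))
                           (≈-trans (+-cong (inner 0 (s≤s z≤n)) ≈-refl) (+-identityˡ _)))

  ∑-insertAll : {A : Set} (f : List A → Carrier) (k : A) (w : List A) →
    ∑ f (insertAll k w) ≈ sumBelow (λ p → f (insertAt p k w)) (suc (length w))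
  ∑-insertAll f k [] = ≈-refl
  ∑-insertAll f k (a ∷ w) =
    +-cong ≈-refl (≈-trans (∑-map f (a ∷_) (insertAll k w)) (∑-insertAll (λ u → f (a ∷ u)) k w))

  ∑-S-suc : ∀ n (g : List ℕ → Carrier) →
    ∑ g (S (suc n)) ≈ sumBelow (λ p → ∑ (λ σ → g (insertAt p (suc n) σ)) (S n)) (suc n)
  ∑-S-suc n g = begin
    ∑ g (S (suc n))
      ≈⟨ ∑-concatMap g (insertAll (suc n)) (S n) ⟩
    ∑ (λ σ → ∑ g (insertAll (suc n) σ)) (S n)
      ≈⟨ ∑-congᴬ (All.map (λ {σ} w → ≈-trans (∑-insertAll g (suc n) σ) (by-length σ (proj₁ w))) (S-windows n)) ⟩
    ∑ (λ σ → sumBelow (λ p → g (insertAt p (suc n) σ)) (suc n)) (S n)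
      ≈⟨ ∑-sumBelow (S n) (λ σ p → g (insertAt p (suc n) σ)) (suc n) ⟩
    sumBelow (λ p → ∑ (λ σ → g (insertAt p (suc n) σ)) (S n)) (suc n) ∎
    where
    by-length : ∀ σ → length σ ≡ n →
      sumBelow (λ p → g (insertAt p (suc n) σ)) (suc (length σ)) ≈ sumBelow (λ p → g (insertAt p (suc n) σ)) (suc n)
    by-length σ len = reflexive (cong (λ l → sumBelow (λ p → g (insertAt p (suc n) σ)) (suc l)) len)

  AntisymAt : ℕ → ℕ → (List ℕ → Carrier) → Set ℓ
  AntisymAt n j g = ∀ pre a b v → length pre ≡ j → IsWindow n (pre ++ a ∷ b ∷ v) →
    g (pre ++ b ∷ a ∷ v) ≈ - g (pre ++ a ∷ b ∷ v)

  -- Inserting the maximum before position j moves the exchanged pair one step right.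
  antisym-before : ∀ n j p → p ≤ j → (g : List ℕ → Carrier) → AntisymAt (suc n) (suc j) g →
    AntisymAt n j (λ σ → g (insertAt p (suc n) σ))
  antisym-before n j p p≤j g anti pre a b v len w =
    subst₂ (λ u u' → g u ≈ - g u') (sym (shift (b ∷ a ∷ v))) (sym (shift (a ∷ b ∷ v)))
      (anti (insertAt p (suc n) pre) a b v (trans (length-insertAt p (suc n) pre) (cong suc len))
            (subst (IsWindow (suc n)) (shift (a ∷ b ∷ v)) (IsWindow-insertAt p w)))
    where
    shift : ∀ rest → insertAt p (suc n) (pre ++ rest) ≡ insertAt p (suc n) pre ++ rest
    shift rest = insertAt-++ˡ p (suc n) pre rest (subst (p ≤_) (sym len) p≤j)

  -- Inserting the maximum after position j + 1 leaves the exchanged pair in place.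
  antisym-after : ∀ n j r (g : List ℕ → Carrier) → AntisymAt (suc n) j g →
    AntisymAt n j (λ σ → g (insertAt (j + suc (suc r)) (suc n) σ))
  antisym-after n j r g anti pre a b v len w =
    subst₂ (λ u u' → g u ≈ - g u') (sym (shift b a)) (sym (shift a b))
      (anti pre a b (insertAt r (suc n) v) len
            (subst (IsWindow (suc n)) (shift a b) (IsWindow-insertAt (j + suc (suc r)) w)))
    where
    shift : ∀ x y → insertAt (j + suc (suc r)) (suc n) (pre ++ x ∷ y ∷ v) ≡ pre ++ x ∷ y ∷ insertAt r (suc n) v
    shift x y = insertAt-++ʳ pre len (suc (suc r)) (suc n) (x ∷ y ∷ v)

  -- Inserting the maximum at positions j and j + 1 produces two words that differ by
  -- exchanging the maximum with its neighbour, so their g-values cancel.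
  antisym-middle : ∀ n j → j < n → (g : List ℕ → Carrier) → AntisymAt (suc n) j g → ∀ σ → IsWindow n σ →
    g (insertAt (j + 0) (suc n) σ) +ᵣ g (insertAt (j + 1) (suc n) σ) ≈ 0#
  antisym-middle n j j<n g anti σ w with splitAt j σ (subst (j <_) (sym (proj₁ w)) j<n)
  ... | pre , a , v , refl , len =
    subst₂ (λ u u' → g u +ᵣ g u' ≈ 0#) (sym (at 0)) (sym (at 1))
      (≈-trans (+-cong ≈-refl (anti pre (suc n) a v len (subst (IsWindow (suc n)) (at 0) (IsWindow-insertAt (j + 0) w))))
               (-‿inverseʳ _))
    where
    at : ∀ p → insertAt (j + p) (suc n) (pre ++ a ∷ v) ≡ pre ++ insertAt p (suc n) (a ∷ v)
    at p = insertAt-++ʳ pre len p (suc n) (a ∷ v)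

  -- A weight that changes sign under exchanging two adjacent entries sums to zero over
  -- S n.  By induction on n, splitting by the position of the maximum n.
  antisym-sum-vanishes : ∀ n j → suc j < n → (g : List ℕ → Carrier) → AntisymAt n j g → ∑ g (S n) ≈ 0#
  antisym-sum-vanishes (suc n) j j+1<n g anti =
    ≈-trans (∑-S-suc n g) (sumBelow-cancel j (suc n) term j+1<n (before j+1<n anti) after middle)
    where
    term : ℕ → Carrier
    term p = ∑ (λ σ → g (insertAt p (suc n) σ)) (S n)
    before : ∀ {j} → suc j < suc n → AntisymAt (suc n) j g → ∀ p → p < j → term p ≈ 0#
    before {suc j} j+1<n anti p (s≤s p≤j) =
      antisym-sum-vanishes n j (ℕP.≤-pred j+1<n) _ (antisym-before n j p p≤j g anti)
    after : ∀ r → j + suc (suc r) < suc n → term (j + suc (suc r)) ≈ 0#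
    after r p<n = antisym-sum-vanishes n j (ℕP.≤-trans (beyond j r) (ℕP.≤-pred p<n)) _ (antisym-after n j r g anti)
      where
      beyond : ∀ j r → suc (suc j) ≤ j + suc (suc r)
      beyond zero r = s≤s (s≤s z≤n)
      beyond (suc j) r = s≤s (beyond j r)
    middle : term (j + 0) +ᵣ term (j + 1) ≈ 0#
    middle = ≈-trans (≈-sym (∑-+ _ _ (S n)))
      (≈-trans (∑-congᴬ (All.map (antisym-middle n j (ℕP.≤-pred j+1<n) g anti _) (S-windows n))) (∑-zero (S n)))

  MaxNeighbourAntisym : ℕ → (List ℕ → Carrier) → Set ℓ
  MaxNeighbourAntisym m F = ∀ pre a b v → IsWindow (suc m) (pre ++ a ∷ b ∷ v) →
    F (pre ++ b ∷ suc (suc m) ∷ a ∷ v) ≈ - F (pre ++ a ∷ suc (suc m) ∷ b ∷ v)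

  ∑-boundary : ∀ m (F : List ℕ → Carrier) → MaxNeighbourAntisym m F →
    ∑ F (S (suc (suc m))) ≈ ∑ (λ σ → F (suc (suc m) ∷ σ)) (S (suc m)) +ᵣ ∑ (λ σ → F (σ ++ suc (suc m) ∷ [])) (S (suc m))
  ∑-boundary m F anti = begin
    ∑ F (S (suc (suc m)))          ≈⟨ ∑-S-suc (suc m) F ⟩
    sumBelow term (suc (suc m))    ≈⟨ sumBelow-ends m term inner ⟩
    term 0 +ᵣ term (suc m)         ≈⟨ +-cong ≈-refl (∑-congᴬ (All.map (λ {σ} w → reflexive (cong F (at-end σ w))) (S-windows (suc m)))) ⟩
    ∑ (λ σ → F (M ∷ σ)) (S (suc m)) +ᵣ ∑ (λ σ → F (σ ++ M ∷ [])) (S (suc m)) ∎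
    where
    M : ℕ
    M = suc (suc m)
    term : ℕ → Carrier
    term p = ∑ (λ σ → F (insertAt p M σ)) (S (suc m))
    inner : ∀ q → q < m → term (q + 1) ≈ 0#
    inner q q<m = antisym-sum-vanishes (suc m) q (s≤s q<m) _ λ pre a b v len w →
      subst₂ (λ u u' → F u ≈ - F u') (sym (insertAt-++ʳ pre len 1 M (b ∷ a ∷ v))) (sym (insertAt-++ʳ pre len 1 M (a ∷ b ∷ v)))
        (anti pre a b v w)
    at-end : ∀ σ → IsWindow (suc m) σ → insertAt (suc m) M σ ≡ σ ++ M ∷ []
    at-end σ w = trans (cong (λ l → insertAt l M σ) (sym (proj₁ w))) (insertAt-end M σ)

  ∑± : (Bool → Carrier) → Carrier
  ∑± f = f true +ᵣ f false

  ∑±-cong : {f g : Bool → Carrier} → (∀ e → f e ≈ g e) → ∑± f ≈ ∑± g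
  ∑±-cong f≈g = +-cong (f≈g true) (f≈g false)

  ∑±-comm : (f : Bool → Bool → Carrier) → ∑± (λ e → ∑± (λ e' → f e e')) ≈ ∑± (λ e' → ∑± (λ e → f e e'))
  ∑±-comm f = interchange _ _ _ _

  ∑±-reverse : (φ : Bool → Bool → Bool → Carrier) →
    ∑± (λ e₁ → ∑± (λ e₂ → ∑± (λ e₃ → φ e₁ e₂ e₃))) ≈ ∑± (λ e₃ → ∑± (λ e₂ → ∑± (λ e₁ → φ e₁ e₂ e₃)))
  ∑±-reverse φ = ≈-trans (∑±-cong (λ e₁ → ∑±-comm (φ e₁)))
                   (≈-trans (∑±-comm (λ e₁ e₃ → ∑± (λ e₂ → φ e₁ e₂ e₃)))
                            (∑±-cong (λ e₃ → ∑±-comm (λ e₁ e₂ → φ e₁ e₂ e₃))))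

  ∑-signings-∷ : (f : List ℤ → Carrier) (a : ℕ) (as : List ℕ) →
    ∑ f (signings (a ∷ as)) ≈ ∑ (λ t → ∑± (λ e → f (sgn e a ∷ t))) (signings as)
  ∑-signings-∷ f a as =
    ≈-trans (∑-concatMap f _ (signings as)) (∑-cong (signings as) (λ t → +-cong ≈-refl (+-identityʳ _)))

  ∑-signings-snoc : (f : List ℤ → Carrier) (σ : List ℕ) (k : ℕ) →
    ∑ f (signings (σ ++ k ∷ [])) ≈ ∑ (λ t → ∑± (λ e → f (t ++ sgn e k ∷ []))) (signings σ)
  ∑-signings-snoc f [] k = ∑-signings-∷ f k []
  ∑-signings-snoc f (a ∷ σ) k = begin
    ∑ f (signings (a ∷ σ ++ k ∷ []))
      ≈⟨ ∑-signings-∷ f a (σ ++ k ∷ []) ⟩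
    ∑ (λ t → ∑± (λ e → f (sgn e a ∷ t))) (signings (σ ++ k ∷ []))
      ≈⟨ ∑-signings-snoc (λ t → ∑± (λ e → f (sgn e a ∷ t))) σ k ⟩
    ∑ (λ t → ∑± (λ e' → ∑± (λ e → f (sgn e a ∷ t ++ sgn e' k ∷ [])))) (signings σ)
      ≈⟨ ∑-cong (signings σ) (λ t → ∑±-comm (λ e' e → f (sgn e a ∷ t ++ sgn e' k ∷ []))) ⟩
    ∑ (λ t → ∑± (λ e → ∑± (λ e' → f (sgn e a ∷ t ++ sgn e' k ∷ [])))) (signings σ)
      ≈⟨ ∑-signings-∷ (λ s → ∑± (λ e' → f (s ++ sgn e' k ∷ []))) a σ ⟨
    ∑ (λ s → ∑± (λ e' → f (s ++ sgn e' k ∷ []))) (signings (a ∷ σ)) ∎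

  ∑-signings-three : (f : List ℤ → Carrier) (a₁ a₂ a₃ : ℕ) (v : List ℕ) →
    ∑ f (signings (a₁ ∷ a₂ ∷ a₃ ∷ v)) ≈
    ∑ (λ t → ∑± (λ e₃ → ∑± (λ e₂ → ∑± (λ e₁ → f (sgn e₁ a₁ ∷ sgn e₂ a₂ ∷ sgn e₃ a₃ ∷ t))))) (signings v)
  ∑-signings-three f a₁ a₂ a₃ v =
    ≈-trans (∑-signings-∷ f a₁ (a₂ ∷ a₃ ∷ v))
      (≈-trans (∑-signings-∷ (λ t → ∑± (λ e₁ → f (sgn e₁ a₁ ∷ t))) a₂ (a₃ ∷ v))
               (∑-signings-∷ (λ t → ∑± (λ e₂ → ∑± (λ e₁ → f (sgn e₁ a₁ ∷ sgn e₂ a₂ ∷ t)))) a₃ v))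

  ∑-signings-swap : (G H : List ℤ → Carrier) (a m b : ℕ) →
    (∀ pre ea em eb v → G (pre ++ sgn eb b ∷ sgn em m ∷ sgn ea a ∷ v) ≈ H (pre ++ sgn ea a ∷ sgn em m ∷ sgn eb b ∷ v)) →
    ∀ pre v → ∑ G (signings (pre ++ b ∷ m ∷ a ∷ v)) ≈ ∑ H (signings (pre ++ a ∷ m ∷ b ∷ v))
  ∑-signings-swap G H a m b G≈H [] v = begin
    ∑ G (signings (b ∷ m ∷ a ∷ v))
      ≈⟨ ∑-signings-three G b m a v ⟩
    ∑ (λ t → ∑± (λ ea → ∑± (λ em → ∑± (λ eb → G (sgn eb b ∷ sgn em m ∷ sgn ea a ∷ t))))) (signings v)
      ≈⟨ ∑-cong (signings v) (λ t → ∑±-cong (λ ea → ∑±-cong (λ em → ∑±-cong (λ eb → G≈H [] ea em eb t)))) ⟩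
    ∑ (λ t → ∑± (λ ea → ∑± (λ em → ∑± (λ eb → H (sgn ea a ∷ sgn em m ∷ sgn eb b ∷ t))))) (signings v)
      ≈⟨ ∑-cong (signings v) (λ t → ∑±-reverse (λ ea em eb → H (sgn ea a ∷ sgn em m ∷ sgn eb b ∷ t))) ⟩
    ∑ (λ t → ∑± (λ eb → ∑± (λ em → ∑± (λ ea → H (sgn ea a ∷ sgn em m ∷ sgn eb b ∷ t))))) (signings v)
      ≈⟨ ∑-signings-three H a m b v ⟨
    ∑ H (signings (a ∷ m ∷ b ∷ v)) ∎
  ∑-signings-swap G H a m b G≈H (c ∷ pre) v =
    ≈-trans (∑-signings-∷ G c (pre ++ b ∷ m ∷ a ∷ v))
      (≈-trans (∑-signings-swap (λ t → ∑± (λ e → G (sgn e c ∷ t))) (λ t → ∑± (λ e → H (sgn e c ∷ t))) a m b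
                  (λ pre' ea em eb v' → ∑±-cong (λ e → G≈H (sgn e c ∷ pre') ea em eb v')) pre v)
               (≈-sym (∑-signings-∷ H c (pre ++ a ∷ m ∷ b ∷ v))))

  _^_ : Carrier → ℕ → Carrier
  _^_ = pow R

  ^-+ : ∀ z i j → z ^ (i + j) ≈ z ^ i * z ^ j
  ^-+ z zero j = ≈-sym (*-identityˡ _)
  ^-+ z (suc i) j = ≈-trans (*-cong ≈-refl (^-+ z i j)) (≈-sym (*-assoc _ _ _))

  -1^-square : ∀ l → (- 1#) ^ l * (- 1#) ^ l ≈ 1#
  -1^-square zero = *-identityˡ 1#
  -1^-square (suc l) =
    ≈-trans (*-cong (-1*x≈-x _) (-1*x≈-x _))
      (≈-trans (neg-square ((- 1#) ^ l)) (-1^-square l))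
    where
    neg-square : ∀ s → - s * - s ≈ s * s
    neg-square s = ≈-trans (≈-sym (-‿distribˡ-* s (- s)))
                     (≈-trans (-‿cong (≈-sym (-‿distribʳ-* s s))) (-‿involutive (s * s)))

  module Weight (x y : Carrier) where

    Φ : List ℤ → Carrier
    Φ τ = (- 1#) ^ ℓD τ * (x ^ oinvD τ * y ^ onspD τ)

    Φ-shift : ∀ τ' τ A B C → ℓD τ' ≡ A + ℓD τ → oinvD τ' ≡ B + oinvD τ → onspD τ' ≡ C + onspD τ →
      Φ τ' ≈ ((- 1#) ^ A * (x ^ B * y ^ C)) * Φ τ
    Φ-shift τ' τ A B C ℓ≡ o≡ n≡ =
      ≈-trans (*-cong (split (- 1#) A (ℓD τ) ℓ≡) (*-cong (split x B (oinvD τ) o≡) (split y C (onspD τ) n≡)))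
        (≈-trans (*-cong ≈-refl (*-interchange _ _ _ _)) (*-interchange _ _ _ _))
      where
      split : ∀ z j k {i} → i ≡ j + k → z ^ i ≈ z ^ j * z ^ k
      split z j k refl = ^-+ z j k

    Φ-front-pos : ∀ {n l} {t : List ℤ} → length t ≡ l → Bounded n t →
      Φ (top true n ∷ t) ≈ ((- 1#) ^ l * x ^ countUpTo odd l) * Φ t
    Φ-front-pos {n} {t = t} refl bounded =
      ≈-trans (Φ-shift (top true n ∷ t) t (length t) _ 0 ℓ≡ oinvD-front onspD-front) (*-cong (*-cong ≈-refl (*-identityʳ _)) ≈-refl)
      where
      open Extreme true bounded
      ℓ≡ : ℓD (top true n ∷ t) ≡ length t + ℓD t
      ℓ≡ = trans (cong₂ _+_ invD-front nspD-front) (ℕP.+-assoc (length t) (invD t) (nspD t))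

    Φ-front-neg : ∀ {n l} {t : List ℤ} → length t ≡ l → Bounded n t →
      Φ (top false n ∷ t) ≈ ((- 1#) ^ l * y ^ countUpTo odd l) * Φ t
    Φ-front-neg {n} {t = t} refl bounded =
      ≈-trans (Φ-shift (top false n ∷ t) t (length t) 0 _ ℓ≡ oinvD-front onspD-front) (*-cong (*-cong ≈-refl (*-identityˡ _)) ≈-refl)
      where
      open Extreme false bounded
      ℓ≡ : ℓD (top false n ∷ t) ≡ length t + ℓD t
      ℓ≡ = trans (cong₂ _+_ invD-front nspD-front)
             (solve 3 (λ i l s → i :+ (l :+ s) := l :+ (i :+ s)) refl (invD t) (length t) (nspD t))

    Φ-back-pos : ∀ {n} {t : List ℤ} → Bounded n t → Φ (t ++ top true n ∷ []) ≈ Φ t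
    Φ-back-pos {n} {t} bounded =
      ≈-trans (Φ-shift (t ++ top true n ∷ []) t 0 0 0 ℓ≡ (trans oinvD-back (ℕP.+-identityʳ _)) (trans onspD-back (ℕP.+-identityʳ _)))
        (≈-trans (*-cong (≈-trans (*-identityˡ _) (*-identityˡ _)) ≈-refl) (*-identityˡ _))
      where
      open Extreme true bounded
      ℓ≡ : ℓD (t ++ top true n ∷ []) ≡ 0 + ℓD t
      ℓ≡ = trans (cong₂ _+_ invD-back nspD-back)
             (solve 2 (λ i s → (i :+ con 0) :+ (s :+ con 0) := i :+ s) refl (invD t) (nspD t))

    Φ-back-neg : ∀ {n l} {t : List ℤ} → length t ≡ l → Bounded n t →
      Φ (t ++ top false n ∷ []) ≈ (x ^ countUpTo odd l * y ^ countUpTo odd l) * Φ t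
    Φ-back-neg {n} {t = t} refl bounded =
      ≈-trans (Φ-shift (t ++ top false n ∷ []) t (l + l) k k ℓ≡ (trans oinvD-back (ℕP.+-comm _ k)) (trans onspD-back (ℕP.+-comm _ k)))
        (*-cong (≈-trans (*-cong (≈-trans (^-+ (- 1#) l l) (-1^-square l)) ≈-refl) (*-identityˡ _)) ≈-refl)
      where
      open Extreme false bounded
      l k : ℕ
      l = length t
      k = countUpTo odd l
      ℓ≡ : ℓD (t ++ top false n ∷ []) ≡ (l + l) + ℓD t
      ℓ≡ = trans (cong₂ _+_ invD-back nspD-back)
             (solve 3 (λ i s l → (i :+ l) :+ (s :+ l) := (l :+ l) :+ (i :+ s)) refl (invD t) (nspD t) l)

    Φ-neg-step : ∀ τ' τ → ℓD τ' ≡ suc (ℓD τ) → oinvD τ' ≡ oinvD τ → onspD τ' ≡ onspD τ → Φ τ' ≈ - Φ τ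
    Φ-neg-step τ' τ ℓ≡ o≡ n≡ =
      ≈-trans (Φ-shift τ' τ 1 0 0 ℓ≡ o≡ n≡)
        (≈-trans (*-cong (≈-trans (*-cong (*-identityʳ (- 1#)) (*-identityˡ 1#)) (*-identityʳ (- 1#))) ≈-refl) (-1*x≈-x _))

    Φ-swap : ∀ {n} e {a b : ℤ} → ℤ.∣ a ∣ ≤ n → ℤ.∣ b ∣ ≤ n → a ≢ b → ∀ pre v →
      Φ (pre ++ b ∷ top e n ∷ a ∷ v) ≈ - Φ (pre ++ a ∷ top e n ∷ b ∷ v)
    Φ-swap {n} e {a} {b} a≤n b≤n a≢b pre v with ℤP.<-cmp a b
    ... | tri< a<b _ _ = Φ-neg-step (pre ++ b ∷ top e n ∷ a ∷ v) (pre ++ a ∷ top e n ∷ b ∷ v) (cong₂ _+_ (invD-swap-< a<b) nspD-swap) oinvD-swap onspD-swap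
      where open ExtremeSwap e {a} {b} a≤n b≤n pre v
    ... | tri≈ _ a≡b _ = ⊥-elim (a≢b a≡b)
    ... | tri> _ _ b<a = ≈-trans (≈-sym (-‿involutive _)) (-‿cong (≈-sym
            (Φ-neg-step (pre ++ a ∷ top e n ∷ b ∷ v) (pre ++ b ∷ top e n ∷ a ∷ v) (cong₂ _+_ (invD-swap-> b<a) (sym nspD-swap)) (sym oinvD-swap) (sym onspD-swap))))
      where open ExtremeSwap e {a} {b} a≤n b≤n pre v

    gate : Bool → Carrier → Carrier
    gate b r = if b then r else 0#

    gate-map : (f : Carrier → Carrier) → f 0# ≈ 0# → ∀ {b b' r r'} → b ≡ b' → r ≈ f r' → gate b r ≈ f (gate b' r')
    gate-map f f0≈0 {false} refl _ = ≈-sym f0≈0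
    gate-map f f0≈0 {true} refl r≈fr' = r≈fr'

    -- The weight restricted to words with an even (e = false) or odd (e = true) number
    -- of negative entries.
    part : Bool → List ℤ → Carrier
    part e τ = gate (e xor ev (neg τ)) (Φ τ)

    parity-flip : ∀ e k → e xor ev (suc k) ≡ not e xor ev k
    parity-flip e k = trans (cong (e xor_) (ev-suc k)) (trans (sym (not-distribʳ-xor e (ev k))) (not-distribˡ-xor e (ev k)))

    partSum : Bool → List ℕ → Carrier
    partSum e σ = ∑ (part e) (signings σ)

    -- Signing the maximum n+1 in front: a negative sign flips the parity.
    partSum-front : ∀ {n l} e σ → length σ ≡ l → All (_≤ n) σ →
      partSum e (suc n ∷ σ) ≈ ((- 1#) ^ l * x ^ countUpTo odd l) * partSum e σ +ᵣ ((- 1#) ^ l * y ^ countUpTo odd l) * partSum (not e) σ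
    partSum-front {n} {l} e σ len bounded =
      ≈-trans (∑-signings-∷ (part e) (suc n) σ)
        (≈-trans (∑-congᴬ (All.map pointwise (signings-shape σ bounded))) (∑-linear cx cy (part e) (part (not e)) (signings σ)))
      where
      cx cy : Carrier
      cx = (- 1#) ^ l * x ^ countUpTo odd l
      cy = (- 1#) ^ l * y ^ countUpTo odd l
      pointwise : ∀ {t} → (length t ≡ length σ) × Bounded n t →
        part e (top true n ∷ t) +ᵣ part e (top false n ∷ t) ≈ cx * part e t +ᵣ cy * part (not e) t
      pointwise {t} (len-t , bd) =
        +-cong (gate-map (cx *_) (zeroʳ cx) refl (Φ-front-pos (trans len-t len) bd))
               (gate-map (cy *_) (zeroʳ cy) (parity-flip e (neg t)) (Φ-front-neg (trans len-t len) bd))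

    partSum-back : ∀ {n l} e σ → length σ ≡ l → All (_≤ n) σ →
      partSum e (σ ++ suc n ∷ []) ≈ partSum e σ +ᵣ (x ^ countUpTo odd l * y ^ countUpTo odd l) * partSum (not e) σ
    partSum-back {n} {l} e σ len bounded =
      ≈-trans (∑-signings-snoc (part e) σ (suc n))
        (≈-trans (∑-congᴬ (All.map pointwise (signings-shape σ bounded)))
                 (≈-trans (∑-+ _ _ (signings σ)) (+-cong ≈-refl (∑-* cxy (part (not e)) (signings σ)))))
      where
      cxy : Carrier
      cxy = x ^ countUpTo odd l * y ^ countUpTo odd l
      pointwise : ∀ {t} → (length t ≡ length σ) × Bounded n t →
        part e (t ++ top true n ∷ []) +ᵣ part e (t ++ top false n ∷ []) ≈ part e t +ᵣ cxy * part (not e) t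
      pointwise {t} (len-t , bd) =
        +-cong (gate-map (λ r → r) ≈-refl (cong (λ k → e xor ev k) (trans (neg-++ t _) (ℕP.+-identityʳ _))) (Φ-back-pos bd))
               (gate-map (cxy *_) (zeroʳ cxy)
                 (trans (cong (λ k → e xor ev k) (trans (neg-++ t _) (ℕP.+-comm (neg t) 1))) (parity-flip e (neg t)))
                 (Φ-back-neg (trans len-t len) bd))

    partSum-antisym : ∀ e m → MaxNeighbourAntisym m (partSum e)
    partSum-antisym e m pre a b v w =
      ≈-trans (∑-signings-swap (part e) (λ τ → - part e τ) a (suc (suc m)) b exchange pre v) (∑-neg (part e) (signings (pre ++ a ∷ suc (suc m) ∷ b ∷ v)))
      where
      bounds : (a ≤ suc m) × (b ≤ suc m)
      bounds = neighbours-bounded pre (proj₁ (proj₂ w))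
      signed-bound : ∀ e' {c} → c ≤ suc m → ℤ.∣ sgn e' c ∣ ≤ suc m
      signed-bound e' {c} c≤ = subst (_≤ suc m) (sym (∣sgn∣ e' c)) c≤
      signed-distinct : ∀ ea eb → sgn ea a ≢ sgn eb b
      signed-distinct ea eb eq =
        neighbours-distinct pre (proj₂ (proj₂ w)) (trans (sym (∣sgn∣ ea a)) (trans (cong ℤ.∣_∣ eq) (∣sgn∣ eb b)))
      exchange : ∀ pre' ea em eb v' →
        part e (pre' ++ sgn eb b ∷ sgn em (suc (suc m)) ∷ sgn ea a ∷ v') ≈ - part e (pre' ++ sgn ea a ∷ sgn em (suc (suc m)) ∷ sgn eb b ∷ v')
      exchange pre' ea em eb v' =
        gate-map -_ -0#≈0# (cong (λ k → e xor ev k) (neg-swap pre' _ _ _ v'))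
          (Φ-swap em (signed-bound ea (proj₁ bounds)) (signed-bound eb (proj₂ bounds)) (signed-distinct ea eb) pre' v')

  -- The S-type weight (-1)^inv z^oinv of σ is the D-type weight of the positive word σ
  -- (with y = 1), which has no negative-sum pairs.
  positive-weight : ∀ z σ → (- 1#) ^ invS σ * z ^ oinvS σ ≈ Weight.Φ z 1# (map +_ σ)
  positive-weight z σ =
    ≈-sym (≈-trans (*-cong (reflexive (cong ((- 1#) ^_) ℓ≡)) (*-cong (reflexive (cong (z ^_) o≡)) (reflexive (cong (1# ^_) n≡))))
                   (*-cong ≈-refl (*-identityʳ _)))
    where
    ℓ≡ : ℓD (map +_ σ) ≡ invS σ
    ℓ≡ = trans (cong₂ _+_ (countPairs-map _ +_ σ) (trans (countPairs-map _ +_ σ) (countPairs-never _ (λ _ _ _ → refl) σ)))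
               (ℕP.+-identityʳ _)
    o≡ : oinvD (map +_ σ) ≡ oinvS σ
    o≡ = countPairs-map _ +_ σ
    never : ∀ d (a b : ℕ) → gated odd negSum d (+ a) (+ b) ≡ false
    never d a b with odd d
    ... | true = refl
    ... | false = refl
    n≡ : onspD (map +_ σ) ≡ 0
    n≡ = trans (countPairs-map _ +_ σ) (countPairs-never _ never σ)

  signedS : Carrier → ℕ → Carrier
  signedS z n = ∑ (λ σ → Weight.Φ z 1# (map +_ σ)) (S n)

  signedS-as-sum : ∀ z n → ∑ (λ σ → (- 1#) ^ invS σ * z ^ oinvS σ) (S n) ≈ signedS z n
  signedS-as-sum z n = ∑-cong (S n) (positive-weight z)

  signedS-one : ∀ z → signedS z 1 ≈ 1#
  signedS-one z = ≈-trans (+-identityʳ _) (≈-trans (*-identityˡ _) (*-identityˡ _))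

  -- f_{m+2}(z) = ((-1)^{m+1} z^k + 1) f_{m+1}(z) with k = ⌈(m+1)/2⌉: the maximum sits
  -- in front or at the end.
  signedS-step : ∀ z m →
    signedS z (suc (suc m)) ≈ ((- 1#) ^ suc m * z ^ countUpTo odd (suc m)) * signedS z (suc m) +ᵣ signedS z (suc m)
  signedS-step z m = ≈-trans (∑-boundary m ψ antisym) (+-cong front back)
    where
    open Weight z 1#
    M : ℕ
    M = suc (suc m)
    c : Carrier
    c = (- 1#) ^ suc m * z ^ countUpTo odd (suc m)
    ψ : List ℕ → Carrier
    ψ σ = Φ (map +_ σ)
    front : ∑ (λ σ → ψ (M ∷ σ)) (S (suc m)) ≈ c * signedS z (suc m)
    front = ≈-trans (∑-congᴬ (All.map (λ {σ} w → Φ-front-pos (trans (length-map +_ σ) (proj₁ w)) (positive-bounded σ (proj₁ (proj₂ w))))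
                                      (S-windows (suc m))))
                    (∑-* c ψ (S (suc m)))
    back : ∑ (λ σ → ψ (σ ++ M ∷ [])) (S (suc m)) ≈ signedS z (suc m)
    back = ∑-congᴬ (All.map (λ {σ} w → ≈-trans (reflexive (cong Φ (map-++ +_ σ (M ∷ []))))
                                               (Φ-back-pos (positive-bounded σ (proj₁ (proj₂ w)))))
                            (S-windows (suc m)))
    antisym : MaxNeighbourAntisym m ψ
    antisym pre a b v w =
      subst₂ (λ u u' → Φ u ≈ - Φ u') (sym (map-++ +_ pre (b ∷ M ∷ a ∷ v))) (sym (map-++ +_ pre (a ∷ M ∷ b ∷ v)))
        (Φ-swap true (proj₁ bounds) (proj₂ bounds) (λ eq → neighbours-distinct pre (proj₂ (proj₂ w)) (cong ℤ.∣_∣ eq))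
                (map +_ pre) (map +_ v))
      where
      bounds : (a ≤ suc m) × (b ≤ suc m)
      bounds = neighbours-bounded pre (proj₁ (proj₂ w))

  product-step : ∀ s X Y fx fy → s * s ≈ 1# →
    ((s * X) * (fx * fy) +ᵣ (s * Y) * (fx * fy)) +ᵣ (fx * fy +ᵣ (X * Y) * (fx * fy)) ≈
    ((s * X) * fx +ᵣ fx) * ((s * Y) * fy +ᵣ fy)
  product-step s X Y fx fy s²≈1 = ≈-sym (begin
    ((s * X) * fx +ᵣ fx) * ((s * Y) * fy +ᵣ fy)
      ≈⟨ ≈-trans (distribʳ _ _ _) (+-cong (distribˡ _ _ _) (distribˡ _ _ _)) ⟩
    (((s * X) * fx) * ((s * Y) * fy) +ᵣ ((s * X) * fx) * fy) +ᵣ (fx * ((s * Y) * fy) +ᵣ fx * fy)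
      ≈⟨ +-cong (+-cong both-signs (*-assoc _ _ _)) (+-cong y-side ≈-refl) ⟩
    ((X * Y) * P +ᵣ (s * X) * P) +ᵣ ((s * Y) * P +ᵣ P)
      ≈⟨ RS.solve 4 (λ a b c p → ((a ⊕ b) ⊕ (c ⊕ p)) ⊜ ((b ⊕ c) ⊕ (p ⊕ a))) ≈-refl
           ((X * Y) * P) ((s * X) * P) ((s * Y) * P) P ⟩
    ((s * X) * P +ᵣ (s * Y) * P) +ᵣ (P +ᵣ (X * Y) * P) ∎)
    where
    P : Carrier
    P = fx * fy
    both-signs : ((s * X) * fx) * ((s * Y) * fy) ≈ (X * Y) * P
    both-signs = ≈-trans (*-interchange _ _ _ _)
      (*-cong (≈-trans (*-interchange _ _ _ _) (≈-trans (*-cong s²≈1 ≈-refl) (*-identityˡ _))) ≈-refl)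
    y-side : fx * ((s * Y) * fy) ≈ (s * Y) * P
    y-side = ≈-trans (≈-sym (*-assoc _ _ _)) (≈-trans (*-cong (*-comm _ _) ≈-refl) (*-assoc _ _ _))

  module Parts (x y : Carrier) where
    open Weight x y

    E : Bool → ℕ → Carrier
    E e n = ∑ (partSum e) (S n)

    D-sum : ∀ n → ∑ Φ (D n) ≈ E false n
    D-sum n = ≈-trans (∑-filter _ Φ (B n)) (∑-concatMap (part false) signings (S n))

    -- n = 1: the word 1 has the even signing +1 and the odd signing -1, both of weight 1.
    E-one : ∀ e → E e 1 ≈ 1#
    E-one false = ≈-trans (+-identityʳ _) (≈-trans (+-cong unit (+-identityʳ 0#)) (+-identityʳ 1#))
      where
      unit : 1# * (1# * 1#) ≈ 1#
      unit = ≈-trans (*-identityˡ _) (*-identityˡ _)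
    E-one true = ≈-trans (+-identityʳ _) (≈-trans (+-identityˡ _) (≈-trans (+-identityʳ _) (≈-trans (*-identityˡ _) (*-identityˡ _))))

    -- The recursion for the parity parts: the signed maximum sits in front or at the end.
    module Step (m : ℕ) where
      s X Y : Carrier
      s = (- 1#) ^ suc m
      X = x ^ countUpTo odd (suc m)
      Y = y ^ countUpTo odd (suc m)

      E-step : ∀ e → E e (suc (suc m)) ≈
        ((s * X) * E e (suc m) +ᵣ (s * Y) * E (not e) (suc m)) +ᵣ (E e (suc m) +ᵣ (X * Y) * E (not e) (suc m))
      E-step e = ≈-trans (∑-boundary m (partSum e) (partSum-antisym e m)) (+-cong front back)
        where
        front : ∑ (λ σ → partSum e (suc (suc m) ∷ σ)) (S (suc m)) ≈ (s * X) * E e (suc m) +ᵣ (s * Y) * E (not e) (suc m)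
        front = ≈-trans (∑-congᴬ (All.map (λ w → partSum-front e _ (proj₁ w) (proj₁ (proj₂ w))) (S-windows (suc m))))
                        (∑-linear (s * X) (s * Y) (partSum e) (partSum (not e)) (S (suc m)))
        back : ∑ (λ σ → partSum e (σ ++ suc (suc m) ∷ [])) (S (suc m)) ≈ E e (suc m) +ᵣ (X * Y) * E (not e) (suc m)
        back = ≈-trans (∑-congᴬ (All.map (λ w → partSum-back e _ (proj₁ w) (proj₁ (proj₂ w))) (S-windows (suc m))))
                       (≈-trans (∑-+ _ _ (S (suc m))) (+-cong ≈-refl (∑-* (X * Y) (partSum (not e)) (S (suc m)))))

    both-parts : ∀ m e → E e (suc m) ≈ signedS x (suc m) * signedS y (suc m)
    both-parts zero e = ≈-trans (E-one e) (≈-sym (≈-trans (*-cong (signedS-one x) (signedS-one y)) (*-identityˡ 1#)))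
    both-parts (suc m) e = begin
      E e (suc (suc m))
        ≈⟨ E-step e ⟩
      ((s * X) * E e (suc m) +ᵣ (s * Y) * E (not e) (suc m)) +ᵣ (E e (suc m) +ᵣ (X * Y) * E (not e) (suc m))
        ≈⟨ +-cong (+-cong (*-cong ≈-refl (both-parts m e)) (*-cong ≈-refl (both-parts m (not e))))
                  (+-cong (both-parts m e) (*-cong ≈-refl (both-parts m (not e)))) ⟩
      ((s * X) * (fx * fy) +ᵣ (s * Y) * (fx * fy)) +ᵣ (fx * fy +ᵣ (X * Y) * (fx * fy))
        ≈⟨ product-step s X Y fx fy (-1^-square (suc m)) ⟩
      ((s * X) * fx +ᵣ fx) * ((s * Y) * fy +ᵣ fy)
        ≈⟨ *-cong (signedS-step x m) (signedS-step y m) ⟨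
      signedS x (suc (suc m)) * signedS y (suc (suc m)) ∎
      where
      open Step m
      fx fy : Carrier
      fx = signedS x (suc m)
      fy = signedS y (suc m)

mainTheorem16 : {c ℓ : Level} (R : CommutativeRing c ℓ) (n : ℕ) → 2 ≤ n →
    (x y : CommutativeRing.Carrier R) →
    CommutativeRing._≈_ R
      (sumR R (map (λ σ → CommutativeRing._*_ R (pow R (CommutativeRing.-_ R (CommutativeRing.1# R)) (ℓD σ))
                     (CommutativeRing._*_ R (pow R x (oinvD σ)) (pow R y (onspD σ)))) (D n)))
      (CommutativeRing._*_ R
        (sumR R (map (λ σ → CommutativeRing._*_ R (pow R (CommutativeRing.-_ R (CommutativeRing.1# R)) (invS σ)) (pow R x (oinvS σ))) (S n)))
        (sumR R (map (λ σ → CommutativeRing._*_ R (pow R (CommutativeRing.-_ R (CommutativeRing.1# R)) (invS σ)) (pow R y (oinvS σ))) (S n))))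
mainTheorem16 R (suc zero) (s≤s ()) x y
mainTheorem16 R (suc (suc m)) _ x y = begin
    ∑ Φ (D n)                      ≈⟨ D-sum n ⟩
    E false n                      ≈⟨ both-parts (suc m) false ⟩
    signedS x n * signedS y n      ≈⟨ *-cong (signedS-as-sum x n) (signedS-as-sum y n) ⟨
    ∑ (λ σ → (- 1#) ^ invS σ * x ^ oinvS σ) (S n) * ∑ (λ σ → (- 1#) ^ invS σ * y ^ oinvS σ) (S n) ∎
  where
  n : ℕ
  n = suc (suc m)
  open CommutativeRing R using (_*_; -_; 1#; *-cong; setoid)
  open Relation.Binary.Reasoning.Setoid setoid
  open Sums R
  open Parts x y
  open Weight x y using (Φ)
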